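{- Let $S$ be a strongly edge decomposable triangulated $(d-1)$-sphere. Then its $g$-vector is nonnegative, i.e. $g_i(S)\ge 0$ for all $0\le i\le\lfloor d/2\rfloor$.
   Context: For a face $F$ of a simplicial complex $M$, $\mathrm{lk}(F,M)=\{T\in M: T\cap F=\emptyset,\ T\cup F\in M\}$. An edge $\{u,v\}$ satisfies the Link Condition if $\mathrm{lk}(u,M)\cap\mathrm{lk}(v,M)=\mathrm{lk}(\{u,v\},M)$; contracting it means replacing $M$ by $\{T: u\notin T\in M\}\cup\{(T\setminus\{u\})\cup\{v\}: u\in T\in M\}$. Definition (recursive): boundary complexes of simplices are strongly edge decomposable, and a triangulated PL-manifold $S$ is strongly edge decomposable if it has an edge satisfying the Link Condition such that both the link of that edge and the complex obtained by contracting it are strongly edge decomposable. For a $(d-1)$-dimensional complex with face numbers $f_{ -1}=1,f_0,\dots,f_{d-1}$, the $h$-vector is defined by $\sum_{i=0}^d h_i x^{d-i}=\sum_{i=0}^d f_{i-1}(x-1)^{d-i}$, and the $g$-vector by $g_0=1$, $g_i=h_i-h_{i-1}$ for $1\le i\le\lfloor d/2\rfloor$. -}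

module Defs where

open import Level using (Lift)
open import Data.Nat using (ℕ; zero; suc; _+_; _*_; _∸_; _≟_)
open import Data.Nat.Combinatorics using (_C_)
open import Data.Integer as ℤ using (ℤ; +_)
open import Data.List using (List; []; _∷_; _++_; length; map; filter; deduplicate; upTo; foldr)
open import Data.List.Membership.Propositional using (_∈_; _∉_)
open import Data.List.Relation.Binary.Subset.Propositional using (_⊆_)
open import Data.List.Relation.Unary.Unique.Propositional using (Unique)
open import Data.Product using (Σ; ∃; ∃-syntax; _×_; _,_)
open import Data.Sum using (_⊎_)
open import Relation.Nullary using (¬_; Dec; ¬?)
open import Relation.Nullary.Decidable using (_×-dec_)
open import Relation.Binary.PropositionalEquality using (_≡_; _≢_)

-- Vertices are natural numbers; a face is a finite set of vertices,
-- represented by a list and always read up to its set of elements.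
-- A (candidate) complex is a predicate on faces.

Cx : Set₁
Cx = List ℕ → Set

_⇔_ : Set → Set → Set
P ⇔ Q = (P → Q) × (Q → P)

_≋_ : List ℕ → List ℕ → Set
A ≋ B = A ⊆ B × B ⊆ A

Disjoint : List ℕ → List ℕ → Set
Disjoint A B = ∀ {x} → x ∈ A → x ∉ B

record IsComplex (M : Cx) : Set where
  field
    dec       : ∀ T → Dec (M T)
    down      : ∀ {T T'} → T' ⊆ T → M T → M T'
    hasEmpty  : M []
    support   : List ℕ
    supported : ∀ T → M T → T ⊆ support

lk : List ℕ → Cx → Cx
lk F M T = Disjoint T F × M (T ++ F)

LinkCondition : Cx → ℕ → ℕ → Set
LinkCondition M u v =
  ∀ T → (lk (u ∷ []) M T × lk (v ∷ []) M T) ⇔ lk (u ∷ v ∷ []) M T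

removeV : ℕ → List ℕ → List ℕ
removeV u = filter (λ x → ¬? (x ≟ u))

Contract : Cx → ℕ → ℕ → Cx
Contract M u v T =
  (u ∉ T × M T) ⊎ (∃[ T' ] (u ∈ T' × M T' × T ≋ (v ∷ removeV u T')))

BdSimplexOn : Cx → List ℕ → Set
BdSimplexOn M B = ∀ T → M T ⇔ (T ⊆ B × ¬ (B ⊆ T))

IsBdSimplex : Cx → Set
IsBdSimplex M = ∃[ B ] (Unique B × B ≢ [] × BdSimplexOn M B)

-- Bistellar move on a (d-1)-dimensional complex: A ∈ M, B ∉ M,
-- |A| + |B| = d + 1, lk(A,M) = ∂B; replace A * ∂B by ∂A * B.
Bistellar : ℕ → Cx → Cx → Set
Bistellar d M M' =
  ∃[ A ] ∃[ B ]
    ( Unique A × Unique B × A ≢ [] × B ≢ [] × Disjoint A B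
    × length A + length B ≡ suc d
    × M A × ¬ M B
    × (∀ T → lk A M T ⇔ (T ⊆ B × ¬ (B ⊆ T)))
    × (∀ T → M' T ⇔ ((M T × ¬ (A ⊆ T))
                    ⊎ (T ⊆ (A ++ B) × B ⊆ T × ¬ (A ⊆ T)))))

-- PLSphere d M : M is a PL (d-1)-sphere, i.e. related by a finite
-- sequence of bistellar moves to the boundary of a simplex with d+1
-- vertices (Pachner's combinatorial characterisation of PL spheres).
data PLSphere (d : ℕ) (M : Cx) : Set₁ where
  base : (B : List ℕ) → Unique B → length B ≡ suc d → BdSimplexOn M B
       → PLSphere d M
  move : (M' : Cx) → Bistellar d M M' → PLSphere d M' → PLSphere d M

PLManifold : ℕ → Cx → Set₁
PLManifold zero    M = Lift _ (IsComplex M × (∀ v → ¬ M (v ∷ [])))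
PLManifold (suc d) M = IsComplex M × (∀ v → M (v ∷ []) → PLSphere d (lk (v ∷ []) M))

data SED (M : Cx) : Set₁ where
  bd    : IsBdSimplex M → SED M
  contr : (d u v : ℕ) → PLManifold d M → u ≢ v → M (u ∷ v ∷ [])
        → LinkCondition M u v
        → SED (lk (u ∷ v ∷ []) M)
        → SED (Contract M u v)
        → SED M

sublists : List ℕ → List (List ℕ)
sublists []       = [] ∷ []
sublists (x ∷ xs) = sublists xs ++ map (x ∷_) (sublists xs)

-- fvec M c j = number of faces with j vertices = f_{j-1}
fvec : (M : Cx) → IsComplex M → ℕ → ℕ
fvec M c j =
  length (filter (λ T → (length T ≟ j) ×-dec IsComplex.dec c T)
                 (sublists (deduplicate _≟_ (IsComplex.support c))))

sumℤ : List ℤ → ℤ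
sumℤ = foldr ℤ._+_ (+ 0)

negOnePow : ℕ → ℤ
negOnePow zero    = + 1
negOnePow (suc k) = ℤ.- negOnePow k

-- h_i = Σ_{j=0}^{i} (-1)^{i-j} C(d-j, i-j) f_{j-1}, the coefficient of
-- x^{d-i} in Σ_j f_{j-1} (x-1)^{d-j}.
hvec : ℕ → (ℕ → ℕ) → ℕ → ℤ
hvec d f i =
  sumℤ (map (λ j → negOnePow (i ∸ j) ℤ.* (+ (((d ∸ j) C (i ∸ j)) * f j)))
            (upTo (suc i)))

gvec : ℕ → (ℕ → ℕ) → ℕ → ℤ
gvec d f zero    = + 1
gvec d f (suc i) = hvec d f (suc i) ℤ.- hvec d f i

-- Contracting an edge uv that satisfies the link condition loses exactly the faces u ∪ T and
-- u ∪ v ∪ T with T ∈ lk(uv), so f(M) = f(M/uv) + (f of the cone over lk(uv), shifted by one).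
-- Because the h-polynomial of a cone equals that of its base, this reads
-- h_{i+1}(M) = h_{i+1}(M/uv) + h_i(lk(uv)), and hence g_{i+1}(M) = g_{i+1}(M/uv) + g_i(lk(uv)).
-- The boundary of a simplex has g = (1, 0, …, 0), so nonnegativity propagates along the strong
-- edge decomposition. Keeping track of dimensions uses that PL spheres, and hence the vertex
-- links of a PL manifold, are pure.
module Submission where

open import Defs
open import Level using (lift)
open import Data.Nat using (ℕ; zero; suc; pred; _∸_; _≤_; _<_; z≤n; s≤s; z<s; s<s; _≟_; ⌊_/2⌋)
import Data.Nat as ℕ
import Data.Nat.Properties as ℕ
open import Data.Nat.Combinatorics using (_C_; nCk+nC[k+1]≡[n+1]C[k+1]; k>n⇒nCk≡0)
open import Data.Integer using (ℤ; +_; +≤+) renaming (_≤_ to _≤ℤ_)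
import Data.Integer.Properties as ℤ
open import Data.List using (List; []; _∷_; _++_; length; map; filter; deduplicate; applyUpTo)
open import Data.List.Properties
  using (map-upTo; length-++; filter-accept; filter-reject; filter-all; filter-notAll)
open import Data.List.Membership.Propositional using (_∈_; _∉_)
open import Data.List.Membership.Propositional.Properties
  using (∈-filter⁻; ∈-filter⁺; ∈-++⁻; ∈-++⁺ˡ; ∈-++⁺ʳ; ∈-map⁻; ∈-deduplicate⁺)
open import Data.List.Membership.DecPropositional _≟_ using (_∈?_)
open import Data.List.Relation.Unary.Any as Any using (here; there)
open import Data.List.Relation.Unary.All as All using ([]; _∷_)
open import Data.List.Relation.Unary.All.Properties using (¬Any⇒All¬; All¬⇒¬Any)
open import Data.List.Relation.Unary.AllPairs using ([]; _∷_)
open import Data.List.Relation.Binary.Subset.DecPropositional _≟_ using (_⊆_; _⊆?_)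
open import Data.List.Relation.Binary.Subset.Propositional.Properties
  using (⊆-trans; ⊆-reflexive-↭; ⊆-respˡ-↭; ⊆∷∧∉⇒⊆; ∈-∷⁺ʳ; ∷⁺ʳ; ++⁺ˡ)
open import Data.List.Relation.Binary.Permutation.Propositional
  using (_↭_; ↭-refl; ↭-sym; prep; swap)
open import Data.List.Relation.Binary.Permutation.Propositional.Properties using (↭-length; ++-comm)
open import Data.List.Relation.Unary.Unique.Propositional as Unique using (Unique)
import Data.List.Relation.Unary.Unique.Propositional.Properties as Unique
open import Data.List.Relation.Unary.Unique.DecPropositional.Properties using (deduplicate-!)
open import Data.Product as Product using (∃-syntax; _×_; _,_; proj₁; proj₂)
open import Data.Sum as Sum using (_⊎_; inj₁; inj₂; [_,_]′)
open import Data.Empty using (⊥-elim)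
open import Function using (_∘_; id; flip; case_of_)
open import Relation.Nullary using (¬_; Dec; yes; no; ¬?; contradiction)
open import Relation.Nullary.Decidable using (_×-dec_; _⊎-dec_; map′)
open import Relation.Binary.PropositionalEquality

module HVector where
  open import Data.Integer using (_+_; _-_; -_; _*_)
  open import Data.Integer.Tactic.RingSolver using (solve-∀)
  open import Algebra.Properties.CommutativeSemigroup ℤ.+-commutativeSemigroup using (interchange)

  minus-interchange : ∀ a b c d → a - b + (c - d) ≡ a + c - (b + d)
  minus-interchange = solve-∀

  sumUpTo : ℕ → (ℕ → ℤ) → ℤ
  sumUpTo n g = sumℤ (applyUpTo g n)

  sumUpTo-cong : ∀ n {g h} → (∀ {j} → j < n → g j ≡ h j) → sumUpTo n g ≡ sumUpTo n h
  sumUpTo-cong zero    g≡h = refl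
  sumUpTo-cong (suc n) g≡h = cong₂ _+_ (g≡h z<s) (sumUpTo-cong n (g≡h ∘ s<s))

  sumUpTo-zero : ∀ n {g} → (∀ {j} → j < n → g j ≡ + 0) → sumUpTo n g ≡ + 0
  sumUpTo-zero zero    g≡0 = refl
  sumUpTo-zero (suc n) g≡0 = cong₂ _+_ (g≡0 z<s) (sumUpTo-zero n (g≡0 ∘ s<s))

  sumUpTo-+ : ∀ n g h → sumUpTo n (λ j → g j + h j) ≡ sumUpTo n g + sumUpTo n h
  sumUpTo-+ zero    g h = refl
  sumUpTo-+ (suc n) g h =
    trans (cong (_+_ (g 0 + h 0)) (sumUpTo-+ n (g ∘ suc) (h ∘ suc)))
          (interchange (g 0) (h 0) (sumUpTo n (g ∘ suc)) (sumUpTo n (h ∘ suc)))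

  sumUpTo-- : ∀ n g h → sumUpTo n (λ j → g j - h j) ≡ sumUpTo n g - sumUpTo n h
  sumUpTo-- zero    g h = refl
  sumUpTo-- (suc n) g h =
    trans (cong (_+_ (g 0 - h 0)) (sumUpTo-- n (g ∘ suc) (h ∘ suc)))
          (minus-interchange (g 0) (h 0) (sumUpTo n (g ∘ suc)) (sumUpTo n (h ∘ suc)))

  sumUpTo-suc : ∀ n g → sumUpTo (suc n) g ≡ sumUpTo n g + g n
  sumUpTo-suc zero    g = trans (ℤ.+-identityʳ (g 0)) (sym (ℤ.+-identityˡ (g 0)))
  sumUpTo-suc (suc n) g =
    trans (cong (_+_ (g 0)) (sumUpTo-suc n (g ∘ suc))) (sym (ℤ.+-assoc (g 0) _ _))

  hTerm : (d i j x : ℕ) → ℤ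
  hTerm d i j x = negOnePow (i ∸ j) * + (((d ∸ j) C (i ∸ j)) ℕ.* x)

  hvec≡sumUpTo : ∀ d f i → hvec d f i ≡ sumUpTo (suc i) (λ j → hTerm d i j (f j))
  hvec≡sumUpTo d f i = cong sumℤ (map-upTo (λ j → hTerm d i j (f j)) (suc i))

  hTerm-zero : ∀ d i j → hTerm d i j 0 ≡ + 0
  hTerm-zero d i j =
    trans (cong (λ n → negOnePow (i ∸ j) * + n) (ℕ.*-zeroʳ ((d ∸ j) C (i ∸ j))))
          (ℤ.*-zeroʳ (negOnePow (i ∸ j)))

  hTerm-+ : ∀ d i j x y → hTerm d i j (x ℕ.+ y) ≡ hTerm d i j x + hTerm d i j y
  hTerm-+ d i j x y = begin
    s * + (c ℕ.* (x ℕ.+ y))           ≡⟨ cong (λ n → s * + n) (ℕ.*-distribˡ-+ c x y) ⟩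
    s * + (c ℕ.* x ℕ.+ c ℕ.* y)       ≡⟨ cong (s *_) (ℤ.pos-+ (c ℕ.* x) (c ℕ.* y)) ⟩
    s * (+ (c ℕ.* x) + + (c ℕ.* y))   ≡⟨ ℤ.*-distribˡ-+ s (+ (c ℕ.* x)) (+ (c ℕ.* y)) ⟩
    s * + (c ℕ.* x) + s * + (c ℕ.* y) ∎
    where
    open ≡-Reasoning
    s : ℤ
    s = negOnePow (i ∸ j)
    c : ℕ
    c = (d ∸ j) C (i ∸ j)

  hTerm-pascal : ∀ {e i j} x → j ≤ i → i ≤ e →
                 hTerm (suc e) (suc i) j x ≡ hTerm e (suc i) j x - hTerm e i j x
  hTerm-pascal {e} {i} {j} x j≤i i≤e
    rewrite ℕ.+-∸-assoc 1 (ℕ.≤-trans j≤i i≤e) | ℕ.+-∸-assoc 1 j≤i = begin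
      - s * + ((suc n C suc k) ℕ.* x)
    ≡⟨ cong (λ c → - s * + (c ℕ.* x)) (sym (nCk+nC[k+1]≡[n+1]C[k+1] n k)) ⟩
      - s * + ((n C k ℕ.+ n C suc k) ℕ.* x)
    ≡⟨ cong (λ m → - s * + m) (ℕ.*-distribʳ-+ x (n C k) (n C suc k)) ⟩
      - s * + ((n C k) ℕ.* x ℕ.+ (n C suc k) ℕ.* x)
    ≡⟨ cong (- s *_) (ℤ.pos-+ ((n C k) ℕ.* x) ((n C suc k) ℕ.* x)) ⟩
      - s * (+ ((n C k) ℕ.* x) + + ((n C suc k) ℕ.* x))
    ≡⟨ distribute s (+ ((n C k) ℕ.* x)) (+ ((n C suc k) ℕ.* x)) ⟩
      - s * + ((n C suc k) ℕ.* x) - s * + ((n C k) ℕ.* x)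
    ∎
    where
    open ≡-Reasoning
    s : ℤ
    s = negOnePow (i ∸ j)
    n k : ℕ
    n = e ∸ j
    k = i ∸ j
    distribute : ∀ s p q → - s * (p + q) ≡ - s * q - s * p
    distribute = solve-∀

  hvec-cong : ∀ d {f g} i → (∀ {j} → j ≤ i → f j ≡ g j) → hvec d f i ≡ hvec d g i
  hvec-cong d {f} {g} i f≡g = begin
    hvec d f i                                ≡⟨ hvec≡sumUpTo d f i ⟩
    sumUpTo (suc i) (λ j → hTerm d i j (f j)) ≡⟨ sumUpTo-cong (suc i) termwise ⟩
    sumUpTo (suc i) (λ j → hTerm d i j (g j)) ≡⟨ hvec≡sumUpTo d g i ⟨
    hvec d g i                                ∎
    where
    open ≡-Reasoning
    termwise : ∀ {j} → j < suc i → hTerm d i j (f j) ≡ hTerm d i j (g j)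
    termwise {j} = cong (hTerm d i j) ∘ f≡g ∘ ℕ.≤-pred

  hvec-+ : ∀ d f g i → hvec d (λ j → f j ℕ.+ g j) i ≡ hvec d f i + hvec d g i
  hvec-+ d f g i = begin
      hvec d (λ j → f j ℕ.+ g j) i
    ≡⟨ hvec≡sumUpTo d (λ j → f j ℕ.+ g j) i ⟩
      sumUpTo (suc i) (λ j → hTerm d i j (f j ℕ.+ g j))
    ≡⟨ sumUpTo-cong (suc i) (λ {j} _ → hTerm-+ d i j (f j) (g j)) ⟩
      sumUpTo (suc i) (λ j → hTerm d i j (f j) + hTerm d i j (g j))
    ≡⟨ sumUpTo-+ (suc i) (λ j → hTerm d i j (f j)) (λ j → hTerm d i j (g j)) ⟩
      sumUpTo (suc i) (λ j → hTerm d i j (f j)) + sumUpTo (suc i) (λ j → hTerm d i j (g j))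
    ≡⟨ cong₂ _+_ (hvec≡sumUpTo d f i) (hvec≡sumUpTo d g i) ⟨
      hvec d f i + hvec d g i
    ∎
    where open ≡-Reasoning

  hvec-zero : ∀ d f → hvec d f 0 ≡ + f 0
  hvec-zero d f = trans (ℤ.+-identityʳ _) (trans (ℤ.*-identityˡ _) (cong +_ (ℕ.+-identityʳ (f 0))))

  shift : (ℕ → ℕ) → ℕ → ℕ
  shift f zero    = 0
  shift f (suc j) = f j

  shift-cong : ∀ {f g} → (∀ j → f j ≡ g j) → ∀ j → shift f j ≡ shift g j
  shift-cong f≡g zero    = refl
  shift-cong f≡g (suc j) = f≡g j

  hvec-shift : ∀ e f i → hvec (suc e) (shift f) (suc i) ≡ hvec e f i
  hvec-shift e f i = begin
    hvec (suc e) (shift f) (suc i)      ≡⟨ hvec≡sumUpTo (suc e) (shift f) (suc i) ⟩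
    hTerm (suc e) (suc i) 0 0 + S       ≡⟨ cong (_+ S) (hTerm-zero (suc e) (suc i) 0) ⟩
    + 0 + S                             ≡⟨ ℤ.+-identityˡ S ⟩
    S                                   ≡⟨ hvec≡sumUpTo e f i ⟨
    hvec e f i                          ∎
    where
    open ≡-Reasoning
    S : ℤ
    S = sumUpTo (suc i) (λ j → hTerm e i j (f j))

  -- Σⱼ fⱼ (x - 1)^(e + 1 - j) is (x - 1) times Σⱼ fⱼ (x - 1)^(e - j).
  hvec-suc : ∀ e f i → i ≤ e → hvec (suc e) f (suc i) ≡ gvec e f (suc i)
  hvec-suc e f i i≤e = begin
    hvec (suc e) f (suc i)                               ≡⟨ hvec≡sumUpTo (suc e) f (suc i) ⟩
    sumUpTo (suc (suc i)) next                           ≡⟨ sumUpTo-suc (suc i) next ⟩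
    sumUpTo (suc i) next + next (suc i)                  ≡⟨ cong₂ _+_ (sumUpTo-cong (suc i) pascal) diagonal ⟩
    sumUpTo (suc i) (λ j → hi j - lo j) + hi (suc i)     ≡⟨ cong (_+ hi (suc i)) (sumUpTo-- (suc i) hi lo) ⟩
    sumUpTo (suc i) hi - sumUpTo (suc i) lo + hi (suc i) ≡⟨ reorder (sumUpTo (suc i) hi) _ (hi (suc i)) ⟩
    sumUpTo (suc i) hi + hi (suc i) - sumUpTo (suc i) lo ≡⟨ cong (_- sumUpTo (suc i) lo) (sumUpTo-suc (suc i) hi) ⟨
    sumUpTo (suc (suc i)) hi - sumUpTo (suc i) lo        ≡⟨ cong₂ _-_ (hvec≡sumUpTo e f (suc i)) (hvec≡sumUpTo e f i) ⟨
    hvec e f (suc i) - hvec e f i                        ∎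
    where
    open ≡-Reasoning
    next hi lo : ℕ → ℤ
    next j = hTerm (suc e) (suc i) j (f j)
    hi   j = hTerm e (suc i) j (f j)
    lo   j = hTerm e i j (f j)
    pascal : ∀ {j} → j < suc i → next j ≡ hi j - lo j
    pascal j<1+i = hTerm-pascal _ (ℕ.≤-pred j<1+i) i≤e
    diagonal : next (suc i) ≡ hi (suc i)
    diagonal rewrite ℕ.n∸n≡0 i = refl
    reorder : ∀ a b c → a - b + c ≡ a + c - b
    reorder = solve-∀

  -- the f-vector of a cone over a complex with f-vector f
  cone : (ℕ → ℕ) → ℕ → ℕ
  cone f j = f j ℕ.+ shift f j

  cone-cong : ∀ {f g} → (∀ j → f j ≡ g j) → ∀ j → cone f j ≡ cone g j
  cone-cong f≡g zero    = cong (ℕ._+ 0) (f≡g 0)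
  cone-cong f≡g (suc j) = cong₂ ℕ._+_ (f≡g (suc j)) (f≡g j)

  shift-cone : ∀ f j → shift (cone f) j ≡ shift f j ℕ.+ shift (shift f) j
  shift-cone f zero    = refl
  shift-cone f (suc j) = refl

  cone-binomial : ∀ n j → cone (n C_) j ≡ suc n C j
  cone-binomial n zero    = refl
  cone-binomial n (suc j) = trans (ℕ.+-comm (n C suc j) (n C j)) (nCk+nC[k+1]≡[n+1]C[k+1] n j)

  hvec-cone : ∀ e f k → k ≤ suc e → hvec (suc e) (cone f) k ≡ hvec e f k
  hvec-cone e f zero    _ =
    trans (hvec-zero (suc e) (cone f)) (trans (cong +_ (ℕ.+-identityʳ (f 0))) (sym (hvec-zero e f)))
  hvec-cone e f (suc i) (s≤s i≤e) = begin
    hvec (suc e) (cone f) (suc i)                           ≡⟨ hvec-+ (suc e) f (shift f) (suc i) ⟩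
    hvec (suc e) f (suc i) + hvec (suc e) (shift f) (suc i) ≡⟨ cong₂ _+_ (hvec-suc e f i i≤e) (hvec-shift e f i) ⟩
    hvec e f (suc i) - hvec e f i + hvec e f i              ≡⟨ cancel (hvec e f (suc i)) (hvec e f i) ⟩
    hvec e f (suc i)                                        ∎
    where
    open ≡-Reasoning
    cancel : ∀ a b → a - b + b ≡ a
    cancel = solve-∀

  hvec-top : ∀ N f → f (suc N) ≡ 0 → hvec N f (suc N) ≡ + 0
  hvec-top N f f[1+N]≡0 = trans (hvec≡sumUpTo N f (suc N)) (sumUpTo-zero (suc (suc N)) vanish)
    where
    vanish : ∀ {j} → j < suc (suc N) → hTerm N (suc N) j (f j) ≡ + 0
    vanish {j} (s≤s j≤1+N) with ℕ.m≤n⇒m<n∨m≡n j≤1+N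
    ... | inj₂ refl = trans (cong (hTerm N (suc N) (suc N)) f[1+N]≡0) (hTerm-zero N (suc N) (suc N))
    ... | inj₁ (s≤s j≤N) rewrite ℕ.+-∸-assoc 1 j≤N | k>n⇒nCk≡0 (ℕ.n<1+n (N ∸ j)) =
      ℤ.*-zeroʳ (negOnePow (suc (N ∸ j)))

  hvec-simplex : ∀ N i → i < N → hvec N (N C_) (suc i) ≡ + 0
  hvec-simplex (suc N) i (s≤s i≤N) = begin
    hvec (suc N) (suc N C_) (suc i)    ≡⟨ hvec-cong (suc N) (suc i) (λ {j} _ → sym (cone-binomial N j)) ⟩
    hvec (suc N) (cone (N C_)) (suc i) ≡⟨ hvec-cone N (N C_) (suc i) (s≤s i≤N) ⟩
    hvec N (N C_) (suc i)              ≡⟨ below-or-top (ℕ.m≤n⇒m<n∨m≡n i≤N) ⟩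
    + 0                                ∎
    where
    open ≡-Reasoning
    below-or-top : i < N ⊎ i ≡ N → hvec N (N C_) (suc i) ≡ + 0
    below-or-top (inj₁ i<N)  = hvec-simplex N i i<N
    below-or-top (inj₂ refl) = hvec-top N (N C_) (k>n⇒nCk≡0 (ℕ.n<1+n N))

  gvec-bdSimplex : ∀ d f i → suc i ≤ d → (∀ {j} → j ≤ d → f j ≡ suc d C j) → gvec d f (suc i) ≡ + 0
  gvec-bdSimplex d f i 1+i≤d f≡C = begin
    gvec d f (suc i)                ≡⟨ hvec-suc d f i (ℕ.<⇒≤ 1+i≤d) ⟨
    hvec (suc d) f (suc i)          ≡⟨ hvec-cong (suc d) (suc i) (f≡C ∘ flip ℕ.≤-trans 1+i≤d) ⟩
    hvec (suc d) (suc d C_) (suc i) ≡⟨ hvec-simplex (suc d) i (s≤s (ℕ.<⇒≤ 1+i≤d)) ⟩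
    + 0                             ∎
    where open ≡-Reasoning

  GNonneg : ℕ → (ℕ → ℕ) → Set
  GNonneg d f = ∀ i → i ≤ ⌊ d /2⌋ → + 0 ≤ℤ gvec d f i

  module _ (e : ℕ) {fM fC fL : ℕ → ℕ} (f-split : ∀ j → fM j ≡ fC j ℕ.+ shift (cone fL) j) where

    private
      d : ℕ
      d = suc (suc e)

      hvec-split : ∀ k → hvec d fM k ≡ hvec d fC k + hvec d (shift (cone fL)) k
      hvec-split k = trans (hvec-cong d k (λ {j} _ → f-split j)) (hvec-+ d fC (shift (cone fL)) k)

      hvec-contraction-zero : hvec d fM 0 ≡ hvec d fC 0
      hvec-contraction-zero = begin
        hvec d fM 0                              ≡⟨ hvec-split 0 ⟩
        hvec d fC 0 + hvec d (shift (cone fL)) 0 ≡⟨ cong (_+_ (hvec d fC 0)) (hvec-zero d (shift (cone fL))) ⟩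
        hvec d fC 0 + + 0                        ≡⟨ ℤ.+-identityʳ (hvec d fC 0) ⟩
        hvec d fC 0                              ∎
        where open ≡-Reasoning

      hvec-contraction-suc : ∀ k → k ≤ suc e → hvec d fM (suc k) ≡ hvec d fC (suc k) + hvec e fL k
      hvec-contraction-suc k k≤1+e = begin
        hvec d fM (suc k)                                    ≡⟨ hvec-split (suc k) ⟩
        hvec d fC (suc k) + hvec d (shift (cone fL)) (suc k) ≡⟨ cong (_+_ (hvec d fC (suc k))) hL ⟩
        hvec d fC (suc k) + hvec e fL k                      ∎
        where
        open ≡-Reasoning
        hL : hvec d (shift (cone fL)) (suc k) ≡ hvec e fL k
        hL = trans (hvec-shift (suc e) (cone fL) k) (hvec-cone e fL k k≤1+e)

    gvec-contraction-one : gvec (suc (suc e)) fM 1 ≡ gvec (suc (suc e)) fC 1 + + fL 0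
    gvec-contraction-one = begin
      hvec d fM 1 - hvec d fM 0               ≡⟨ cong₂ _-_ (hvec-contraction-suc 0 z≤n) hvec-contraction-zero ⟩
      hvec d fC 1 + hvec e fL 0 - hvec d fC 0 ≡⟨ reorder (hvec d fC 1) (hvec e fL 0) (hvec d fC 0) ⟩
      hvec d fC 1 - hvec d fC 0 + hvec e fL 0 ≡⟨ cong (_+_ (gvec d fC 1)) (hvec-zero e fL) ⟩
      gvec d fC 1 + + fL 0                    ∎
      where
      open ≡-Reasoning
      reorder : ∀ a b c → a + b - c ≡ a - c + b
      reorder = solve-∀

    gvec-contraction : ∀ i → suc i ≤ e →
      gvec (suc (suc e)) fM (suc (suc i)) ≡ gvec (suc (suc e)) fC (suc (suc i)) + gvec e fL (suc i)
    gvec-contraction i 1+i≤e = begin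
        hvec d fM (suc (suc i)) - hvec d fM (suc i)
      ≡⟨ cong₂ _-_ (hvec-contraction-suc (suc i) 1+i≤1+e) (hvec-contraction-suc i (ℕ.<⇒≤ 1+i≤1+e)) ⟩
        hvec d fC (suc (suc i)) + hvec e fL (suc i) - (hvec d fC (suc i) + hvec e fL i)
      ≡⟨ minus-interchange (hvec d fC (suc (suc i))) (hvec d fC (suc i)) (hvec e fL (suc i)) (hvec e fL i) ⟨
        gvec d fC (suc (suc i)) + gvec e fL (suc i)
      ∎
      where
      open ≡-Reasoning
      1+i≤1+e : suc i ≤ suc e
      1+i≤1+e = ℕ.m≤n⇒m≤1+n 1+i≤e

    gNonneg-contraction : GNonneg (suc (suc e)) fC → GNonneg e fL → GNonneg (suc (suc e)) fM
    gNonneg-contraction gC gL zero          _ = +≤+ z≤n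
    gNonneg-contraction gC gL (suc zero)    _ =
      subst (+ 0 ≤ℤ_) (sym gvec-contraction-one) (ℤ.+-mono-≤ (gC 1 (s≤s z≤n)) (+≤+ z≤n))
    gNonneg-contraction gC gL (suc (suc i)) (s≤s 1+i≤e/2) =
      subst (+ 0 ≤ℤ_) (sym (gvec-contraction i (ℕ.≤-trans 1+i≤e/2 (ℕ.⌊n/2⌋≤n e))))
            (ℤ.+-mono-≤ (gC (suc (suc i)) (s≤s 1+i≤e/2)) (gL (suc i) 1+i≤e/2))

open HVector

open import Data.Nat using (_+_)
open import Data.Nat.Tactic.RingSolver using (solve-∀)
open import Algebra.Properties.CommutativeSemigroup ℕ.+-commutativeSemigroup using (interchange)

-- Lists as finite sets

unique-∷ : ∀ {x : ℕ} {L} → x ∉ L → Unique L → Unique (x ∷ L)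
unique-∷ {L = L} x∉L uL = ¬Any⇒All¬ L x∉L ∷ uL

unique-head : ∀ {x : ℕ} {L} → Unique (x ∷ L) → x ∉ L
unique-head (x∉L ∷ _) = All¬⇒¬Any x∉L

unique-++ : ∀ {A B} → Unique A → Unique B → Disjoint A B → Unique (A ++ B)
unique-++ uA uB A∩B=∅ = Unique.++⁺ uA uB (λ (p , q) → A∩B=∅ p q)

⊈⇒missing : ∀ {B T : List ℕ} → ¬ B ⊆ T → ∃[ b ] (b ∈ B × b ∉ T)
⊈⇒missing {[]}    B⊈T = contradiction (λ ()) B⊈T
⊈⇒missing {b ∷ B} {T} B⊈T with b ∈? T
... | no  b∉T = b , here refl , b∉T
... | yes b∈T with ⊈⇒missing {B} (B⊈T ∘ ∈-∷⁺ʳ b∈T)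
...   | c , c∈B , c∉T = c , there c∈B , c∉T

module _ {x : ℕ} where

  private
    ≢x? : ∀ z → Dec (z ≢ x)
    ≢x? z = ¬? (z ≟ x)

  ∈-removeV⁻ : ∀ {z} L → z ∈ removeV x L → z ∈ L × z ≢ x
  ∈-removeV⁻ L = ∈-filter⁻ ≢x?

  ∈-removeV⁺ : ∀ {z L} → z ∈ L → z ≢ x → z ∈ removeV x L
  ∈-removeV⁺ = ∈-filter⁺ ≢x?

  ∉-removeV : ∀ L → x ∉ removeV x L
  ∉-removeV L p = proj₂ (∈-removeV⁻ L p) refl

  removeV-⊆ : ∀ L → removeV x L ⊆ L
  removeV-⊆ L = proj₁ ∘ ∈-removeV⁻ L

  removeV-unique : ∀ {L} → Unique L → Unique (removeV x L)
  removeV-unique = Unique.filter⁺ ≢x?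

  removeV-∷ : ∀ L → removeV x (x ∷ L) ≡ removeV x L
  removeV-∷ L = filter-reject ≢x? (λ x≢x → x≢x refl)

  removeV-∷-≢ : ∀ {y} L → y ≢ x → removeV x (y ∷ L) ≡ y ∷ removeV x L
  removeV-∷-≢ L = filter-accept ≢x?

  removeV-∉ : ∀ {L} → x ∉ L → removeV x L ≡ L
  removeV-∉ {L} x∉L = filter-all ≢x? (All.map (_∘ sym) (¬Any⇒All¬ L x∉L))

  length-removeV< : ∀ {L} → x ∈ L → length (removeV x L) < length L
  length-removeV< {L} x∈L = filter-notAll ≢x? L (Any.map (λ { refl z≢z → z≢z refl }) x∈L)

unique-⊆⇒length≤ : ∀ {X Y} → Unique X → X ⊆ Y → length X ≤ length Y
unique-⊆⇒length≤ {[]}    _            _   = z≤n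
unique-⊆⇒length≤ {x ∷ X} {Y} (x∉X ∷ uX) X⊆Y =
  ℕ.≤-trans (s≤s (unique-⊆⇒length≤ uX X⊆Y-x)) (length-removeV< (X⊆Y (here refl)))
  where
  X⊆Y-x : X ⊆ removeV x Y
  X⊆Y-x p = ∈-removeV⁺ (X⊆Y (there p)) λ { refl → All¬⇒¬Any x∉X p }

unique-⊆⇒length< : ∀ {X Y y} → Unique X → X ⊆ Y → y ∈ Y → y ∉ X → length X < length Y
unique-⊆⇒length< {X} {Y} {y} uX X⊆Y y∈Y y∉X =
  ℕ.≤-trans (s≤s (unique-⊆⇒length≤ uX X⊆Y-y)) (length-removeV< y∈Y)
  where
  X⊆Y-y : X ⊆ removeV y Y
  X⊆Y-y p = ∈-removeV⁺ (X⊆Y p) λ { refl → y∉X p }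

length-removeV : ∀ {x L} → Unique L → x ∈ L → suc (length (removeV x L)) ≡ length L
length-removeV {x} {L} uL x∈L =
  ℕ.≤-antisym (length-removeV< x∈L) (unique-⊆⇒length≤ uL L⊆x∷L-x)
  where
  L⊆x∷L-x : L ⊆ x ∷ removeV x L
  L⊆x∷L-x {z} z∈L with z ≟ x
  ... | yes refl = here refl
  ... | no  z≢x  = there (∈-removeV⁺ z∈L z≢x)

sublists-⊆ : ∀ W {T} → T ∈ sublists W → T ⊆ W
sublists-⊆ []      (here refl) ()
sublists-⊆ (x ∷ W) T∈ p with ∈-++⁻ (sublists W) T∈
... | inj₁ T∈W = there (sublists-⊆ W T∈W p)
... | inj₂ T∈x∷W with ∈-map⁻ (x ∷_) T∈x∷W
...   | _ , T′∈W , refl with p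
...     | here refl = here refl
...     | there q   = there (sublists-⊆ W T′∈W q)

-- Counting faces

indicator : ∀ {P : Set} → Dec P → ℕ
indicator (yes _) = 1
indicator (no  _) = 0

indicator-⇔ : ∀ {P Q : Set} → P ⇔ Q → (p : Dec P) (q : Dec Q) → indicator p ≡ indicator q
indicator-⇔ _         (yes _) (yes _) = refl
indicator-⇔ (P→Q , _) (yes p) (no ¬q) = contradiction (P→Q p) ¬q
indicator-⇔ (_ , Q→P) (no ¬p) (yes q) = contradiction (Q→P q) ¬p
indicator-⇔ _         (no _)  (no _)  = refl

indicator-yes : ∀ {P : Set} → P → (p : Dec P) → indicator p ≡ 1
indicator-yes _ (yes _) = refl
indicator-yes p (no ¬p) = contradiction p ¬p

indicator-no : ∀ {P : Set} → ¬ P → (p : Dec P) → indicator p ≡ 0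
indicator-no ¬p (yes p) = contradiction p ¬p
indicator-no _  (no _)  = refl

indicator-×-yes : ∀ {P Q : Set} → P → (p : Dec P) (q : Dec Q) →
                  indicator (p ×-dec q) ≡ indicator q
indicator-×-yes p p? q? = indicator-⇔ (proj₂ , (p ,_)) (p? ×-dec q?) q?

indicator-×-no : ∀ {P Q : Set} → ¬ P → (p : Dec P) (q : Dec Q) → indicator (p ×-dec q) ≡ 0
indicator-×-no ¬p p? q? = indicator-no (¬p ∘ proj₁) (p? ×-dec q?)

indicator-inclusion-exclusion : ∀ {E P Q R S : Set} → R ⇔ (P ⊎ Q) → S ⇔ (P × Q) →
  (e : Dec E) (p : Dec P) (q : Dec Q) (r : Dec R) (s : Dec S) →
  indicator (e ×-dec p) + indicator (e ×-dec q) ≡ indicator (e ×-dec r) + indicator (e ×-dec s)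
indicator-inclusion-exclusion _ _ (no ¬e) p q r s =
  trans (cong₂ _+_ (indicator-×-no ¬e (no ¬e) p) (indicator-×-no ¬e (no ¬e) q))
        (sym (cong₂ _+_ (indicator-×-no ¬e (no ¬e) r) (indicator-×-no ¬e (no ¬e) s)))
indicator-inclusion-exclusion {P = P} {Q} (R→P∪Q , P∪Q→R) (S→P∩Q , P∩Q→S) (yes e) p q r s =
  trans (cong₂ _+_ (indicator-×-yes e (yes e) p) (indicator-×-yes e (yes e) q))
        (trans (unguarded p q)
               (sym (cong₂ _+_ (indicator-×-yes e (yes e) r) (indicator-×-yes e (yes e) s))))
  where
  unguarded : (p : Dec P) (q : Dec Q) → indicator p + indicator q ≡ indicator r + indicator s
  unguarded (yes p) (yes q) =
    sym (cong₂ _+_ (indicator-yes (P∪Q→R (inj₁ p)) r) (indicator-yes (P∩Q→S (p , q)) s))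
  unguarded (yes p) (no ¬q) =
    sym (cong₂ _+_ (indicator-yes (P∪Q→R (inj₁ p)) r) (indicator-no (¬q ∘ proj₂ ∘ S→P∩Q) s))
  unguarded (no ¬p) (yes q) =
    sym (cong₂ _+_ (indicator-yes (P∪Q→R (inj₂ q)) r) (indicator-no (¬p ∘ proj₁ ∘ S→P∩Q) s))
  unguarded (no ¬p) (no ¬q) =
    sym (cong₂ _+_ (indicator-no ([ ¬p , ¬q ]′ ∘ R→P∪Q) r) (indicator-no (¬p ∘ proj₁ ∘ S→P∩Q) s))

sumOver : (List ℕ → ℕ) → List (List ℕ) → ℕ
sumOver F []       = 0
sumOver F (T ∷ Ts) = F T + sumOver F Ts

sumOver-++ : ∀ F Ts Us → sumOver F (Ts ++ Us) ≡ sumOver F Ts + sumOver F Us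
sumOver-++ F []       Us = refl
sumOver-++ F (T ∷ Ts) Us =
  trans (cong (_+_ (F T)) (sumOver-++ F Ts Us)) (sym (ℕ.+-assoc (F T) (sumOver F Ts) (sumOver F Us)))

sumOver-map : ∀ F g Ts → sumOver F (map g Ts) ≡ sumOver (F ∘ g) Ts
sumOver-map F g []       = refl
sumOver-map F g (T ∷ Ts) = cong (_+_ (F (g T))) (sumOver-map F g Ts)

sumOver-cong : ∀ {F G} Ts → (∀ {T} → T ∈ Ts → F T ≡ G T) → sumOver F Ts ≡ sumOver G Ts
sumOver-cong []       F≡G = refl
sumOver-cong (T ∷ Ts) F≡G = cong₂ _+_ (F≡G (here refl)) (sumOver-cong Ts (F≡G ∘ there))

sumOver-zero : ∀ {F} Ts → (∀ {T} → T ∈ Ts → F T ≡ 0) → sumOver F Ts ≡ 0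
sumOver-zero []       F≡0 = refl
sumOver-zero (T ∷ Ts) F≡0 = cong₂ _+_ (F≡0 (here refl)) (sumOver-zero Ts (F≡0 ∘ there))

sumOver-+ : ∀ F G Ts → sumOver (λ T → F T + G T) Ts ≡ sumOver F Ts + sumOver G Ts
sumOver-+ F G []       = refl
sumOver-+ F G (T ∷ Ts) =
  trans (cong (_+_ (F T + G T)) (sumOver-+ F G Ts))
        (interchange (F T) (G T) (sumOver F Ts) (sumOver G Ts))

length-filter≡sumOver : ∀ {P : List ℕ → Set} (P? : ∀ T → Dec (P T)) Ts →
                        length (filter P? Ts) ≡ sumOver (indicator ∘ P?) Ts
length-filter≡sumOver P? []       = refl
length-filter≡sumOver P? (T ∷ Ts) with P? T
... | yes _ = cong suc (length-filter≡sumOver P? Ts)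
... | no  _ = length-filter≡sumOver P? Ts

PermInvariant : (List ℕ → ℕ) → Set
PermInvariant F = ∀ {T T′} → T ↭ T′ → F T ≡ F T′

sumOver-sublists-∷ : ∀ F x U →
  sumOver F (sublists (x ∷ U)) ≡ sumOver F (sublists U) + sumOver (F ∘ (x ∷_)) (sublists U)
sumOver-sublists-∷ F x U =
  trans (sumOver-++ F (sublists U) (map (x ∷_) (sublists U)))
        (cong (_+_ (sumOver F (sublists U))) (sumOver-map F (x ∷_) (sublists U)))

sumOver-sublists-removeV : ∀ {F} → PermInvariant F → ∀ {x U} → Unique U → x ∈ U →
  sumOver F (sublists U) ≡ sumOver F (sublists (removeV x U)) + sumOver (F ∘ (x ∷_)) (sublists (removeV x U))
sumOver-sublists-removeV {F} F-inv {x} {x ∷ U} uU (here refl) =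
  trans (sumOver-sublists-∷ F x U)
        (cong (λ R → sumOver F (sublists R) + sumOver (F ∘ (x ∷_)) (sublists R))
              (sym (trans (removeV-∷ U) (removeV-∉ (unique-head uU)))))
sumOver-sublists-removeV {F} F-inv {x} {y ∷ U} uU (there x∈U) = begin
    sumOver F (sublists (y ∷ U))
  ≡⟨ sumOver-sublists-∷ F y U ⟩
    S F U + S (F ∘ (y ∷_)) U
  ≡⟨ cong₂ _+_ (split F F-inv) (split (F ∘ (y ∷_)) (F-inv ∘ prep y)) ⟩
    (S F R + S (F ∘ (x ∷_)) R) + (S (F ∘ (y ∷_)) R + S (F ∘ (y ∷_) ∘ (x ∷_)) R)
  ≡⟨ cong (λ s → (S F R + S (F ∘ (x ∷_)) R) + (S (F ∘ (y ∷_)) R + s)) swap-xy ⟩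
    (S F R + S (F ∘ (x ∷_)) R) + (S (F ∘ (y ∷_)) R + S (F ∘ (x ∷_) ∘ (y ∷_)) R)
  ≡⟨ interchange (S F R) (S (F ∘ (x ∷_)) R) (S (F ∘ (y ∷_)) R) (S (F ∘ (x ∷_) ∘ (y ∷_)) R) ⟩
    (S F R + S (F ∘ (y ∷_)) R) + (S (F ∘ (x ∷_)) R + S (F ∘ (x ∷_) ∘ (y ∷_)) R)
  ≡⟨ cong₂ _+_ (sumOver-sublists-∷ F y R) (sumOver-sublists-∷ (F ∘ (x ∷_)) y R) ⟨
    S F (y ∷ R) + S (F ∘ (x ∷_)) (y ∷ R)
  ≡⟨ cong (λ R′ → S F R′ + S (F ∘ (x ∷_)) R′) (removeV-∷-≢ U y≢x) ⟨
    S F (removeV x (y ∷ U)) + S (F ∘ (x ∷_)) (removeV x (y ∷ U))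
  ∎
  where
  open ≡-Reasoning
  R : List ℕ
  R = removeV x U
  S : (List ℕ → ℕ) → List ℕ → ℕ
  S G W = sumOver G (sublists W)
  y≢x : y ≢ x
  y≢x refl = unique-head uU x∈U
  split : ∀ G → PermInvariant G → S G U ≡ S G R + S (G ∘ (x ∷_)) R
  split G G-inv = sumOver-sublists-removeV G-inv (Unique.tail uU) x∈U
  swap-xy : S (F ∘ (y ∷_) ∘ (x ∷_)) R ≡ S (F ∘ (x ∷_) ∘ (y ∷_)) R
  swap-xy = sumOver-cong (sublists R) (λ _ → F-inv (swap y x ↭-refl))

faceIndicator : ∀ {P : Cx} → (∀ T → Dec (P T)) → (k j : ℕ) → List ℕ → ℕ
faceIndicator P? k j T = indicator ((k + length T ≟ j) ×-dec P? T)

faceCount : ∀ {P : Cx} → (∀ T → Dec (P T)) → List ℕ → (k j : ℕ) → ℕ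
faceCount P? U k j = sumOver (faceIndicator P? k j) (sublists U)

vertices : ∀ {M} → IsComplex M → List ℕ
vertices c = deduplicate _≟_ (IsComplex.support c)

fvec≡faceCount : ∀ {M} (c : IsComplex M) j → fvec M c j ≡ faceCount (IsComplex.dec c) (vertices c) 0 j
fvec≡faceCount c j = length-filter≡sumOver _ (sublists (vertices c))

shift-faceCount : ∀ {P : Cx} (P? : ∀ T → Dec (P T)) U k j →
                  shift (faceCount P? U k) j ≡ faceCount P? U (suc k) j
shift-faceCount P? U k zero    =
  sym (sumOver-zero (sublists U) λ {T} _ → indicator-×-no (λ ()) (suc (k + length T) ≟ 0) (P? T))
shift-faceCount P? U k (suc j) =
  sumOver-cong (sublists U) λ _ → indicator-⇔ (Product.map₁ (cong suc) , Product.map₁ ℕ.suc-injective) _ _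

Resp↭ : Cx → Set
Resp↭ P = ∀ {T T′} → T ↭ T′ → P T → P T′

faceIndicator-invariant : ∀ {P : Cx} (P? : ∀ T → Dec (P T)) → Resp↭ P →
                          ∀ k j → PermInvariant (faceIndicator P? k j)
faceIndicator-invariant P? P-resp k j T↭T′ =
  indicator-⇔ (Product.map (trans (cong (_+_ k) (sym (↭-length T↭T′)))) (P-resp T↭T′)
             , Product.map (trans (cong (_+_ k) (↭-length T↭T′))) (P-resp (↭-sym T↭T′))) _ _

faceCount-⊆[] : ∀ U j → faceCount (_⊆? []) U 0 j ≡ 0 C j
faceCount-⊆[] []      zero    = refl
faceCount-⊆[] []      (suc j) = refl
faceCount-⊆[] (x ∷ U) j = begin
    faceCount (_⊆? []) (x ∷ U) 0 j
  ≡⟨ sumOver-sublists-∷ (faceIndicator (_⊆? []) 0 j) x U ⟩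
    faceCount (_⊆? []) U 0 j + sumOver (faceIndicator (_⊆? []) 0 j ∘ (x ∷_)) (sublists U)
  ≡⟨ cong (_+_ (faceCount (_⊆? []) U 0 j)) (sumOver-zero (sublists U) x∷T⊈[]) ⟩
    faceCount (_⊆? []) U 0 j + 0
  ≡⟨ ℕ.+-identityʳ _ ⟩
    faceCount (_⊆? []) U 0 j
  ≡⟨ faceCount-⊆[] U j ⟩
    0 C j
  ∎
  where
  open ≡-Reasoning
  x∷T⊈[] : ∀ {T} → T ∈ sublists U → faceIndicator (_⊆? []) 0 j (x ∷ T) ≡ 0
  x∷T⊈[] {T} _ = indicator-no (λ (_ , x∷T⊆[]) → case x∷T⊆[] (here refl) of λ ()) _

faceCount-⊆ : ∀ {B U} → Unique B → Unique U → B ⊆ U → ∀ j → faceCount (_⊆? B) U 0 j ≡ length B C j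
faceCount-⊆ {[]}    {U} _  _  _   j = faceCount-⊆[] U j
faceCount-⊆ {x ∷ B} {U} uB uU B⊆U j = begin
    faceCount (_⊆? x ∷ B) U 0 j
  ≡⟨ sumOver-sublists-removeV (faceIndicator-invariant (_⊆? x ∷ B) ⊆-respˡ-↭ 0 j) uU (B⊆U (here refl)) ⟩
    sumOver (faceIndicator (_⊆? x ∷ B) 0 j) (sublists U-x)
      + sumOver (faceIndicator (_⊆? x ∷ B) 0 j ∘ (x ∷_)) (sublists U-x)
  ≡⟨ cong₂ _+_ (sumOver-cong (sublists U-x) without-x) (sumOver-cong (sublists U-x) with-x) ⟩
    faceCount (_⊆? B) U-x 0 j + faceCount (_⊆? B) U-x 1 j
  ≡⟨ cong (_+_ (faceCount (_⊆? B) U-x 0 j)) (shift-faceCount (_⊆? B) U-x 0 j) ⟨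
    cone (faceCount (_⊆? B) U-x 0) j
  ≡⟨ cone-cong (faceCount-⊆ (Unique.tail uB) (removeV-unique uU) B⊆U-x) j ⟩
    cone (length B C_) j
  ≡⟨ cone-binomial (length B) j ⟩
    suc (length B) C j
  ∎
  where
  open ≡-Reasoning
  U-x : List ℕ
  U-x = removeV x U
  B⊆U-x : B ⊆ U-x
  B⊆U-x p = ∈-removeV⁺ (B⊆U (there p)) λ { refl → unique-head uB p }
  x∉ : ∀ {T} → T ∈ sublists U-x → x ∉ T
  x∉ T∈ = ∉-removeV U ∘ sublists-⊆ U-x T∈
  without-x : ∀ {T} → T ∈ sublists U-x → faceIndicator (_⊆? x ∷ B) 0 j T ≡ faceIndicator (_⊆? B) 0 j T
  without-x T∈ = indicator-⇔ ( (λ (e , T⊆x∷B) → e , ⊆∷∧∉⇒⊆ T⊆x∷B (x∉ T∈))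
                             , (λ (e , T⊆B) → e , there ∘ T⊆B)) _ _
  with-x : ∀ {T} → T ∈ sublists U-x → faceIndicator (_⊆? x ∷ B) 0 j (x ∷ T) ≡ faceIndicator (_⊆? B) 1 j T
  with-x T∈ = indicator-⇔ ( (λ (e , x∷T⊆x∷B) → e , ⊆∷∧∉⇒⊆ (x∷T⊆x∷B ∘ there) (x∉ T∈))
                          , (λ (e , T⊆B) → e , ∷⁺ʳ x T⊆B)) _ _

-- Links and edge contractions

Down : Cx → Set
Down M = ∀ {T T′} → T′ ⊆ T → M T → M T′

down-resp↭ : ∀ {M} → Down M → Resp↭ M
down-resp↭ down = down ∘ ⊆-reflexive-↭ ∘ ↭-sym

disjoint? : ∀ T F → Dec (Disjoint T F)
disjoint? T F = map′ All.lookup All.tabulate (All.all? (λ x → ¬? (x ∈? F)) T)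

lk⇔ : ∀ {M : Cx} → Down M → ∀ {F T} → Disjoint T F → lk F M T ⇔ M (F ++ T)
lk⇔ down {F} {T} T∩F=∅ = down-resp↭ down (++-comm T F) ∘ proj₂
                       , λ F∪T∈M → T∩F=∅ , down-resp↭ down (++-comm F T) F∪T∈M

lk-isComplex : ∀ {M F} → IsComplex M → M F → IsComplex (lk F M)
lk-isComplex {M} {F} c F∈M = record
  { dec       = λ T → disjoint? T F ×-dec dec (T ++ F)
  ; down      = λ T′⊆T (T∩F=∅ , T∪F∈M) → T∩F=∅ ∘ T′⊆T , down (++⁺ˡ F T′⊆T) T∪F∈M
  ; hasEmpty  = (λ ()) , F∈M
  ; support   = support
  ; supported = λ T (_ , T∪F∈M) → supported (T ++ F) T∪F∈M ∘ ∈-++⁺ˡ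
  }
  where open IsComplex c

module _ {M : Cx} (c : IsComplex M) {u v : ℕ} (u≢v : u ≢ v) where
  open IsComplex c

  ContractFace : List ℕ → Set
  ContractFace T = u ∉ T × (M T ⊎ (v ∈ T × M (u ∷ removeV v T)))

  Contract⇒ContractFace : ∀ {T} → Contract M u v T → ContractFace T
  Contract⇒ContractFace (inj₁ u∉T,T∈M) = Product.map₂ inj₁ u∉T,T∈M
  Contract⇒ContractFace {T} (inj₂ (T′ , u∈T′ , T′∈M , T⊆ , ⊆T)) =
    u∉T , inj₂ (⊆T (here refl) , down u∷T-v⊆T′ T′∈M)
    where
    u∉T : u ∉ T
    u∉T p with T⊆ p
    ... | here u≡v = u≢v u≡v
    ... | there q  = ∉-removeV T′ q
    u∷T-v⊆T′ : u ∷ removeV v T ⊆ T′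
    u∷T-v⊆T′ (here refl) = u∈T′
    u∷T-v⊆T′ (there p) with ∈-removeV⁻ T p
    ... | z∈T , z≢v with T⊆ z∈T
    ...   | here z≡v = contradiction z≡v z≢v
    ...   | there q  = removeV-⊆ T′ q

  ContractFace⇒Contract : ∀ {T} → ContractFace T → Contract M u v T
  ContractFace⇒Contract (u∉T , inj₁ T∈M) = inj₁ (u∉T , T∈M)
  ContractFace⇒Contract {T} (u∉T , inj₂ (v∈T , u∷T-v∈M)) =
    inj₂ (u ∷ removeV v T , here refl , u∷T-v∈M , T⊆ , ⊆T)
    where
    T⊆ : T ⊆ v ∷ removeV u (u ∷ removeV v T)
    T⊆ {z} z∈T with z ≟ v
    ... | yes refl = here refl
    ... | no  z≢v  = there (∈-removeV⁺ {L = u ∷ removeV v T} (there (∈-removeV⁺ z∈T z≢v)) λ { refl → u∉T z∈T })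
    ⊆T : v ∷ removeV u (u ∷ removeV v T) ⊆ T
    ⊆T (here refl) = v∈T
    ⊆T (there p) with ∈-removeV⁻ (u ∷ removeV v T) p
    ... | here z≡u , z≢u = contradiction z≡u z≢u
    ... | there q  , _   = removeV-⊆ T q

  contract-isComplex : M (u ∷ v ∷ []) → IsComplex (Contract M u v)
  contract-isComplex uv∈M = record
    { dec       = λ T → map′ ContractFace⇒Contract Contract⇒ContractFace (contractFace? T)
    ; down      = λ T′⊆T → ContractFace⇒Contract ∘ contractFace-down T′⊆T ∘ Contract⇒ContractFace
    ; hasEmpty  = inj₁ ((λ ()) , hasEmpty)
    ; support   = support
    ; supported = λ T → contractFace-supported T ∘ Contract⇒ContractFace
    }
    where
    contractFace? : ∀ T → Dec (ContractFace T)
    contractFace? T = ¬? (u ∈? T) ×-dec (dec T ⊎-dec (v ∈? T ×-dec dec (u ∷ removeV v T)))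
    contractFace-down : ∀ {T T′} → T′ ⊆ T → ContractFace T → ContractFace T′
    contractFace-down T′⊆T (u∉T , inj₁ T∈M) = u∉T ∘ T′⊆T , inj₁ (down T′⊆T T∈M)
    contractFace-down {T} {T′} T′⊆T (u∉T , inj₂ (v∈T , u∷T-v∈M)) with v ∈? T′
    ... | yes v∈T′ = u∉T ∘ T′⊆T , inj₂ (v∈T′ , down (∷⁺ʳ u T′-v⊆T-v) u∷T-v∈M)
      where
      T′-v⊆T-v : removeV v T′ ⊆ removeV v T
      T′-v⊆T-v p = let z∈T′ , z≢v = ∈-removeV⁻ T′ p in ∈-removeV⁺ (T′⊆T z∈T′) z≢v
    ... | no  v∉T′ = u∉T ∘ T′⊆T , inj₁ (down T′⊆u∷T-v u∷T-v∈M)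
      where
      T′⊆u∷T-v : T′ ⊆ u ∷ removeV v T
      T′⊆u∷T-v z∈T′ = there (∈-removeV⁺ (T′⊆T z∈T′) λ { refl → v∉T′ z∈T′ })
    contractFace-supported : ∀ T → ContractFace T → T ⊆ support
    contractFace-supported T (_ , inj₁ T∈M) = supported T T∈M
    contractFace-supported T (_ , inj₂ (_ , u∷T-v∈M)) {z} z∈T with z ≟ v
    ... | yes refl = supported (u ∷ v ∷ []) uv∈M (there (here refl))
    ... | no  z≢v  = supported (u ∷ removeV v T) u∷T-v∈M (there (∈-removeV⁺ z∈T z≢v))

module ContractionCount {M : Cx} (c : IsComplex M) {u v : ℕ} (u≢v : u ≢ v) (uv∈M : M (u ∷ v ∷ []))
                        (link-condition : LinkCondition M u v) where
  open IsComplex c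

  M/uv L : Cx
  M/uv = Contract M u v
  L    = lk (u ∷ v ∷ []) M

  c/uv : IsComplex M/uv
  c/uv = contract-isComplex c u≢v uv∈M

  cL : IsComplex L
  cL = lk-isComplex c uv∈M

  private
    module _ {T : List ℕ} (u∉T : u ∉ T) (v∉T : v ∉ T) where

      contract-avoiding : M/uv T ⇔ M T
      contract-avoiding = [ id , (λ (v∈T , _) → contradiction v∈T v∉T) ]′ ∘ proj₂ ∘ Contract⇒ContractFace c u≢v
                        , ContractFace⇒Contract c u≢v ∘ (u∉T ,_) ∘ inj₁

      contract-v∷ : M/uv (v ∷ T) ⇔ (M (u ∷ T) ⊎ M (v ∷ T))
      contract-v∷ = Sum.swap ∘ Sum.map₂ (subst (M ∘ (u ∷_)) v∷T-v≡T ∘ proj₂) ∘ proj₂ ∘ Contract⇒ContractFace c u≢v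
                  , ContractFace⇒Contract c u≢v ∘ (u∉v∷T ,_) ∘ Sum.map₂ from-u ∘ Sum.swap
        where
        v∷T-v≡T : removeV v (v ∷ T) ≡ T
        v∷T-v≡T = trans (removeV-∷ T) (removeV-∉ v∉T)
        u∉v∷T : u ∉ v ∷ T
        u∉v∷T (here u≡v) = u≢v u≡v
        u∉v∷T (there p)  = u∉T p
        from-u : M (u ∷ T) → v ∈ v ∷ T × M (u ∷ removeV v (v ∷ T))
        from-u u∷T∈M = here refl , subst (M ∘ (u ∷_)) (sym v∷T-v≡T) u∷T∈M

      link-uv : L T ⇔ M (u ∷ v ∷ T)
      link-uv = lk⇔ down T∩uv=∅
        where
        T∩uv=∅ : Disjoint T (u ∷ v ∷ [])
        T∩uv=∅ p (here refl)         = u∉T p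
        T∩uv=∅ p (there (here refl)) = v∉T p

      link-u-and-v : L T ⇔ (M (u ∷ T) × M (v ∷ T))
      link-u-and-v = Product.map (proj₁ (lk⇔ down u∉)) (proj₁ (lk⇔ down v∉)) ∘ proj₂ (link-condition T)
                   , proj₁ (link-condition T) ∘ Product.map (proj₂ (lk⇔ down u∉)) (proj₂ (lk⇔ down v∉))
        where
        u∉ : Disjoint T (u ∷ [])
        u∉ p (here refl) = u∉T p
        v∉ : Disjoint T (v ∷ [])
        v∉ p (here refl) = v∉T p

    group : (List ℕ → ℕ) → List ℕ → ℕ
    group F T = (F T + F (v ∷ T)) + (F (u ∷ T) + F (u ∷ v ∷ T))

    sumOver-group : ∀ {F} → PermInvariant F → ∀ {U} → Unique U → u ∈ U → v ∈ U →
                    sumOver F (sublists U) ≡ sumOver (group F) (sublists (removeV v (removeV u U)))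
    sumOver-group {F} F-inv {U} uU u∈U v∈U = begin
        sumOver F (sublists U)
      ≡⟨ sumOver-sublists-removeV F-inv uU u∈U ⟩
        S F U-u + S (F ∘ (u ∷_)) U-u
      ≡⟨ cong₂ _+_ (split F F-inv) (split (F ∘ (u ∷_)) (F-inv ∘ prep u)) ⟩
        (S F W + S (F ∘ (v ∷_)) W) + (S (F ∘ (u ∷_)) W + S (F ∘ (u ∷_) ∘ (v ∷_)) W)
      ≡⟨ cong₂ _+_ (sumOver-+ F (F ∘ (v ∷_)) (sublists W))
                   (sumOver-+ (F ∘ (u ∷_)) (F ∘ (u ∷_) ∘ (v ∷_)) (sublists W)) ⟨
        S (λ T → F T + F (v ∷ T)) W + S (λ T → F (u ∷ T) + F (u ∷ v ∷ T)) W
      ≡⟨ sumOver-+ (λ T → F T + F (v ∷ T)) (λ T → F (u ∷ T) + F (u ∷ v ∷ T)) (sublists W) ⟨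
        S (group F) W
      ∎
      where
      open ≡-Reasoning
      U-u W : List ℕ
      U-u = removeV u U
      W   = removeV v U-u
      S : (List ℕ → ℕ) → List ℕ → ℕ
      S G X = sumOver G (sublists X)
      split : ∀ G → PermInvariant G → S G U-u ≡ S G W + S (G ∘ (v ∷_)) W
      split G G-inv = sumOver-sublists-removeV G-inv (removeV-unique uU) (∈-removeV⁺ v∈U (u≢v ∘ sym))

    χM χM/uv : ℕ → List ℕ → ℕ
    χM    = faceIndicator dec 0
    χM/uv = faceIndicator (IsComplex.dec c/uv) 0

    χL : ℕ → ℕ → List ℕ → ℕ
    χL j k = faceIndicator (IsComplex.dec cL) k j

    module _ (j : ℕ) {T : List ℕ} (u∉T : u ∉ T) (v∉T : v ∉ T) where

      group-contract : group (χM/uv j) T ≡ χM/uv j T + χM/uv j (v ∷ T)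
      group-contract =
        trans (cong (_+_ (χM/uv j T + χM/uv j (v ∷ T))) (cong₂ _+_ (∌u T) (∌u (v ∷ T))))
              (ℕ.+-identityʳ _)
        where
        ∌u : ∀ X → χM/uv j (u ∷ X) ≡ 0
        ∌u X = indicator-no (λ (_ , u∷X∈M/uv) → proj₁ (Contract⇒ContractFace c u≢v u∷X∈M/uv) (here refl)) _

      group-link : ∀ k → group (χL j k) T ≡ χL j k T
      group-link k =
        trans (cong₂ (λ a b → (χL j k T + a) + b) (∌ (there (here refl))) (cong₂ _+_ (∌ (here refl)) (∌ (here refl))))
              (trans (ℕ.+-identityʳ (χL j k T + 0)) (ℕ.+-identityʳ (χL j k T)))
        where
        ∌ : ∀ {x X} → x ∈ u ∷ v ∷ [] → χL j k (x ∷ X) ≡ 0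
        ∌ x∈uv = indicator-no (λ (_ , x∷X∩uv=∅ , _) → x∷X∩uv=∅ (here refl) x∈uv) _

      -- M/uv merges u ∪ T and v ∪ T into v ∪ T; by the link condition both are faces of M
      -- exactly when T ∈ lk(uv), which is also exactly when u ∪ v ∪ T is one.
      group-faceIndicator : group (χM j) T ≡ group (χM/uv j) T + (group (χL j 1) T + group (χL j 2) T)
      group-faceIndicator = begin
          (χM j T + χM j (v ∷ T)) + (χM j (u ∷ T) + χM j (u ∷ v ∷ T))
        ≡⟨ cong₂ (λ x y → (x + χM j (v ∷ T)) + (χM j (u ∷ T) + y)) avoiding-uv containing-uv ⟩
          (χM/uv j T + χM j (v ∷ T)) + (χM j (u ∷ T) + χL j 2 T)
        ≡⟨ reassociate (χM/uv j T) (χM j (v ∷ T)) (χM j (u ∷ T)) (χL j 2 T) ⟩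
          χM/uv j T + (χM j (u ∷ T) + χM j (v ∷ T)) + χL j 2 T
        ≡⟨ cong (λ x → χM/uv j T + x + χL j 2 T) containing-u-or-v ⟩
          χM/uv j T + (χM/uv j (v ∷ T) + χL j 1 T) + χL j 2 T
        ≡⟨ regroup (χM/uv j T) (χM/uv j (v ∷ T)) (χL j 1 T) (χL j 2 T) ⟩
          (χM/uv j T + χM/uv j (v ∷ T)) + (χL j 1 T + χL j 2 T)
        ≡⟨ cong₂ _+_ group-contract (cong₂ _+_ (group-link 1) (group-link 2)) ⟨
          group (χM/uv j) T + (group (χL j 1) T + group (χL j 2) T)
        ∎
        where
        open ≡-Reasoning
        reassociate : ∀ a b c d → (a + b) + (c + d) ≡ a + (c + b) + d
        reassociate = solve-∀
        regroup : ∀ a b c d → a + (b + c) + d ≡ (a + b) + (c + d)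
        regroup = solve-∀
        avoiding-uv : χM j T ≡ χM/uv j T
        avoiding-uv = indicator-⇔ ( Product.map₂ (proj₂ (contract-avoiding u∉T v∉T))
                                  , Product.map₂ (proj₁ (contract-avoiding u∉T v∉T))) _ _
        containing-uv : χM j (u ∷ v ∷ T) ≡ χL j 2 T
        containing-uv = indicator-⇔ ( Product.map₂ (proj₂ (link-uv u∉T v∉T))
                                    , Product.map₂ (proj₁ (link-uv u∉T v∉T))) _ _
        containing-u-or-v : χM j (u ∷ T) + χM j (v ∷ T) ≡ χM/uv j (v ∷ T) + χL j 1 T
        containing-u-or-v = indicator-inclusion-exclusion (contract-v∷ u∉T v∉T) (link-u-and-v u∉T v∉T)
          (suc (length T) ≟ j) (dec (u ∷ T)) (dec (v ∷ T)) (IsComplex.dec c/uv (v ∷ T)) (IsComplex.dec cL T)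

    faceCount-contraction : ∀ j →
      faceCount dec (vertices c) 0 j
        ≡ faceCount (IsComplex.dec c/uv) (vertices c) 0 j
          + (faceCount (IsComplex.dec cL) (vertices c) 1 j + faceCount (IsComplex.dec cL) (vertices c) 2 j)
    faceCount-contraction j = begin
        sumOver (χM j) (sublists U)
      ≡⟨ sumOver-group (invariant c 0) uU u∈U v∈U ⟩
        S (χM j)
      ≡⟨ sumOver-cong (sublists W) (λ T∈ → group-faceIndicator j (u∉ T∈) (v∉ T∈)) ⟩
        sumOver (λ T → group (χM/uv j) T + (group (χL j 1) T + group (χL j 2) T)) (sublists W)
      ≡⟨ sumOver-+ (group (χM/uv j)) (λ T → group (χL j 1) T + group (χL j 2) T) (sublists W) ⟩
        S (χM/uv j) + sumOver (λ T → group (χL j 1) T + group (χL j 2) T) (sublists W)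
      ≡⟨ cong (_+_ (S (χM/uv j))) (sumOver-+ (group (χL j 1)) (group (χL j 2)) (sublists W)) ⟩
        S (χM/uv j) + (S (χL j 1) + S (χL j 2))
      ≡⟨ cong₂ _+_ (sumOver-group (invariant c/uv 0) uU u∈U v∈U)
                   (cong₂ _+_ (sumOver-group (invariant cL 1) uU u∈U v∈U)
                              (sumOver-group (invariant cL 2) uU u∈U v∈U)) ⟨
        sumOver (χM/uv j) (sublists U) + (sumOver (χL j 1) (sublists U) + sumOver (χL j 2) (sublists U))
      ∎
      where
      open ≡-Reasoning
      U W : List ℕ
      U = vertices c
      W = removeV v (removeV u U)
      S : (List ℕ → ℕ) → ℕ
      S F = sumOver (group F) (sublists W)
      uU : Unique U
      uU = deduplicate-! _≟_ support
      u∈U : u ∈ U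
      u∈U = ∈-deduplicate⁺ _≟_ (supported (u ∷ v ∷ []) uv∈M (here refl))
      v∈U : v ∈ U
      v∈U = ∈-deduplicate⁺ _≟_ (supported (u ∷ v ∷ []) uv∈M (there (here refl)))
      u∉ : ∀ {T} → T ∈ sublists W → u ∉ T
      u∉ T∈ = ∉-removeV U ∘ removeV-⊆ (removeV u U) ∘ sublists-⊆ W T∈
      v∉ : ∀ {T} → T ∈ sublists W → v ∉ T
      v∉ T∈ = ∉-removeV (removeV u U) ∘ sublists-⊆ W T∈
      invariant : ∀ {K} (cK : IsComplex K) k → PermInvariant (faceIndicator (IsComplex.dec cK) k j)
      invariant cK k = faceIndicator-invariant (IsComplex.dec cK) (down-resp↭ (IsComplex.down cK)) k j

  fvec-contraction : ∀ j → fvec M c j ≡ fvec M/uv c/uv j + shift (cone (fvec L cL)) j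
  fvec-contraction j = begin
      fvec M c j
    ≡⟨ fvec≡faceCount c j ⟩
      faceCount dec U 0 j
    ≡⟨ faceCount-contraction j ⟩
      faceCount dec/uv U 0 j + (faceCount decL U 1 j + faceCount decL U 2 j)
    ≡⟨ cong₂ _+_ (fvec≡faceCount c/uv j) (cong₂ _+_ shifted-once shifted-twice) ⟨
      fvec M/uv c/uv j + (shift fL j + shift (shift fL) j)
    ≡⟨ cong (_+_ (fvec M/uv c/uv j)) (shift-cone fL j) ⟨
      fvec M/uv c/uv j + shift (cone fL) j
    ∎
    where
    open ≡-Reasoning
    U : List ℕ
    U = vertices c
    dec/uv : ∀ T → Dec (M/uv T)
    dec/uv = IsComplex.dec c/uv
    decL : ∀ T → Dec (L T)
    decL = IsComplex.dec cL
    fL : ℕ → ℕ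
    fL = fvec L cL
    shifted-once : ∀ {j} → shift fL j ≡ faceCount decL U 1 j
    shifted-once {j} = trans (shift-cong (fvec≡faceCount cL) j) (shift-faceCount decL U 0 j)
    shifted-twice : shift (shift fL) j ≡ faceCount decL U 2 j
    shifted-twice = trans (shift-cong (λ _ → shifted-once) j) (shift-faceCount decL U 1 j)

-- Purity of PL spheres

record FacetAvoiding (k : ℕ) (M : Cx) (T : List ℕ) (x : ℕ) : Set where
  constructor facetAvoiding
  field
    facet        : List ℕ
    facet-unique : Unique facet
    facet-face   : M facet
    facet-size   : length facet ≡ k
    ⊆facet       : T ⊆ facet
    ∉facet       : x ∉ facet

-- Mere purity does not survive a bistellar move; the avoidance clause does, and it also yields
-- the facets of an edge contraction.
record Pure (k : ℕ) (M : Cx) : Set where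
  field
    size≤  : ∀ {T} → Unique T → M T → length T ≤ k
    extend : ∀ {T x} → M T → x ∉ T → FacetAvoiding k M T x

choose-missing : ∀ {B T} x → ¬ B ⊆ T → x ∉ T → ∃[ b ] (b ∈ B × b ∉ T × x ∉ removeV b B)
choose-missing {B} x B⊈T x∉T with x ∈? B | ⊈⇒missing B⊈T
... | yes x∈B | _             = x , x∈B , x∉T , ∉-removeV B
... | no  x∉B | b , b∈B , b∉T = b , b∈B , b∉T , x∉B ∘ removeV-⊆ B

⊆-removeV : ∀ {T B b} → T ⊆ B → b ∉ T → T ⊆ removeV b B
⊆-removeV T⊆B b∉T z∈T = ∈-removeV⁺ (T⊆B z∈T) λ { refl → b∉T z∈T }

bdSimplex⇒pure : ∀ {k M B} → Unique B → length B ≡ suc k → BdSimplexOn M B → Pure k M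
bdSimplex⇒pure {k} {M} {B} uB |B|≡1+k M≡∂B = record { size≤ = size≤ ; extend = extend }
  where
  size≤ : ∀ {T} → Unique T → M T → length T ≤ k
  size≤ {T} uT T∈M with proj₁ (M≡∂B T) T∈M
  ... | T⊆B , B⊈T with ⊈⇒missing B⊈T
  ...   | b , b∈B , b∉T =
    ℕ.≤-pred (subst (length T <_) |B|≡1+k (unique-⊆⇒length< uT T⊆B b∈B b∉T))
  extend : ∀ {T x} → M T → x ∉ T → FacetAvoiding k M T x
  extend {T} {x} T∈M x∉T with proj₁ (M≡∂B T) T∈M
  ... | T⊆B , B⊈T with choose-missing x B⊈T x∉T
  ...   | b , b∈B , b∉T , x∉B-b = facetAvoiding (removeV b B) (removeV-unique uB)
          (proj₂ (M≡∂B (removeV b B)) (removeV-⊆ B , λ B⊆B-b → ∉-removeV B (B⊆B-b b∈B)))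
          (ℕ.suc-injective (trans (length-removeV uB b∈B) |B|≡1+k))
          (⊆-removeV T⊆B b∉T) x∉B-b

module BistellarMove {k : ℕ} {M M′ : Cx} (down : Down M) {A B : List ℕ}
  (uA : Unique A) (uB : Unique B) (A∩B=∅ : Disjoint A B)
  (size : length A + length B ≡ suc k) (B∉M : ¬ M B)
  (lk-A : ∀ T → lk A M T ⇔ (T ⊆ B × ¬ (B ⊆ T)))
  (M′-def : ∀ T → M′ T ⇔ ((M T × ¬ (A ⊆ T)) ⊎ (T ⊆ (A ++ B) × B ⊆ T × ¬ (A ⊆ T))))
  where

  -- the facets A ∪ (B − b) of A * ∂B
  Δ : ℕ → List ℕ
  Δ b = removeV b B ++ A

  Δ-unique : ∀ b → Unique (Δ b)
  Δ-unique b = unique-++ (removeV-unique uB) uA (λ z∈B-b z∈A → A∩B=∅ z∈A (removeV-⊆ B z∈B-b))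

  Δ-face : ∀ {b} → b ∈ B → M (Δ b)
  Δ-face {b} b∈B = proj₂ (proj₂ (lk-A (removeV b B)) (removeV-⊆ B , λ B⊆B-b → ∉-removeV B (B⊆B-b b∈B)))

  Δ-size : ∀ {b} → b ∈ B → length (Δ b) ≡ k
  Δ-size {b} b∈B = ℕ.suc-injective (begin
    suc (length (removeV b B ++ A))       ≡⟨ cong suc (length-++ (removeV b B)) ⟩
    suc (length (removeV b B) + length A) ≡⟨ cong (_+ length A) (length-removeV uB b∈B) ⟩
    length B + length A                   ≡⟨ ℕ.+-comm (length B) (length A) ⟩
    length A + length B                   ≡⟨ size ⟩
    suc k                                 ∎)
    where open ≡-Reasoning

  ⊆Δ : ∀ {T b} → T ⊆ A ++ B → b ∉ T → T ⊆ Δ b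
  ⊆Δ {T} {b} T⊆A∪B b∉T {z} z∈T with ∈-++⁻ A (T⊆A∪B z∈T)
  ... | inj₁ z∈A = ∈-++⁺ʳ (removeV b B) z∈A
  ... | inj₂ z∈B = ∈-++⁺ˡ (∈-removeV⁺ z∈B λ { refl → b∉T z∈T })

  star-A : ∀ {T} → M T → A ⊆ T → T ⊆ A ++ B
  star-A {T} T∈M A⊆T {z} z∈T with z ∈? A
  ... | yes z∈A = ∈-++⁺ˡ z∈A
  ... | no  z∉A = ∈-++⁺ʳ A (T-A⊆B (∈-filter⁺ ∉A? z∈T z∉A))
    where
    ∉A? : ∀ z → Dec (z ∉ A)
    ∉A? z = ¬? (z ∈? A)
    T-A : List ℕ
    T-A = filter ∉A? T
    T-A∩A=∅ : Disjoint T-A A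
    T-A∩A=∅ = proj₂ ∘ ∈-filter⁻ ∉A? {xs = T}
    T-A∪A⊆T : T-A ++ A ⊆ T
    T-A∪A⊆T p = [ proj₁ ∘ ∈-filter⁻ ∉A? {xs = T} , A⊆T ]′ (∈-++⁻ T-A p)
    T-A⊆B : T-A ⊆ B
    T-A⊆B = proj₁ (proj₁ (lk-A T-A) (T-A∩A=∅ , down T-A∪A⊆T T∈M))

  M′-face : ∀ {G} → M′ G → M G ⊎ (G ⊆ A ++ B × B ⊆ G)
  M′-face {G} G∈M′ = Sum.map proj₁ (λ (G⊆A∪B , B⊆G , _) → G⊆A∪B , B⊆G) (proj₁ (M′-def G) G∈M′)

  A⊈M′ : ∀ {G} → M′ G → ¬ A ⊆ G
  A⊈M′ {G} G∈M′ = [ proj₂ , proj₂ ∘ proj₂ ]′ (proj₁ (M′-def G) G∈M′)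

  M′-outside : ∀ {T} → M T → ¬ A ⊆ T → M′ T
  M′-outside T∈M A⊈T = proj₂ (M′-def _) (inj₁ (T∈M , A⊈T))

  down′ : Down M′
  down′ {T} {T′} T′⊆T T∈M′ with proj₁ (M′-def T) T∈M′
  ... | inj₁ (T∈M , A⊈T) = M′-outside (down T′⊆T T∈M) (A⊈T ∘ flip ⊆-trans T′⊆T)
  ... | inj₂ (T⊆A∪B , B⊆T , A⊈T) with B ⊆? T′
  ...   | yes B⊆T′ = proj₂ (M′-def T′) (inj₂ (T⊆A∪B ∘ T′⊆T , B⊆T′ , A⊈T ∘ flip ⊆-trans T′⊆T))
  ...   | no  B⊈T′ with ⊈⇒missing B⊈T′
  ...     | b , b∈B , b∉T′ =
    M′-outside (down (⊆Δ (T⊆A∪B ∘ T′⊆T) b∉T′) (Δ-face b∈B)) (A⊈T ∘ flip ⊆-trans T′⊆T)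

  module _ (P′ : Pure k M′) where
    open Pure P′ renaming (size≤ to size′≤; extend to extend′)

    extend-outside : ∀ {T x} → M T → ¬ T ⊆ A ++ B → x ∉ T → FacetAvoiding k M T x
    extend-outside {T} {x} T∈M T⊈A∪B x∉T = transfer (extend′ T∈M′ x∉T)
      where
      T∈M′ : M′ T
      T∈M′ = M′-outside T∈M (λ A⊆T → T⊈A∪B (star-A T∈M A⊆T))
      transfer : FacetAvoiding k M′ T x → FacetAvoiding k M T x
      transfer (facetAvoiding G uG G∈M′ |G|≡k T⊆G x∉G) =
        facetAvoiding G uG G∈M |G|≡k T⊆G x∉G
        where
        G∈M : M G
        G∈M = [ id , (λ (G⊆A∪B , _) → ⊥-elim (T⊈A∪B (⊆-trans T⊆G G⊆A∪B))) ]′ (M′-face G∈M′)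

    -- (A − x) ∪ (B − b) is a face of M missing x ∈ A, hence a face of M′; there it extends to
    -- a facet avoiding b, which therefore does not contain B and is a face of M.
    extend-from-A : ∀ {T x b} → T ⊆ A ++ B → x ∉ T → x ∈ A → b ∈ B → b ∉ T → FacetAvoiding k M T x
    extend-from-A {T} {x} {b} T⊆A∪B x∉T x∈A b∈B b∉T = transfer (extend′ T₁∈M′ b∉T₁)
      where
      T₁ : List ℕ
      T₁ = removeV x A ++ removeV b B
      T⊆T₁ : T ⊆ T₁
      T⊆T₁ {z} z∈T with ∈-++⁻ A (T⊆A∪B z∈T)
      ... | inj₁ z∈A = ∈-++⁺ˡ (∈-removeV⁺ z∈A λ { refl → x∉T z∈T })
      ... | inj₂ z∈B = ∈-++⁺ʳ (removeV x A) (∈-removeV⁺ z∈B λ { refl → b∉T z∈T })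
      x∉T₁ : x ∉ T₁
      x∉T₁ = [ ∉-removeV A , (λ x∈B-b → A∩B=∅ x∈A (removeV-⊆ B x∈B-b)) ]′ ∘ ∈-++⁻ (removeV x A)
      b∉T₁ : b ∉ T₁
      b∉T₁ = [ (λ b∈A-x → A∩B=∅ (removeV-⊆ A b∈A-x) b∈B) , ∉-removeV B ]′ ∘ ∈-++⁻ (removeV x A)
      T₁⊆Δ : T₁ ⊆ Δ b
      T₁⊆Δ p = [ ∈-++⁺ʳ (removeV b B) ∘ removeV-⊆ A , ∈-++⁺ˡ ]′ (∈-++⁻ (removeV x A) p)
      T₁∈M′ : M′ T₁
      T₁∈M′ = M′-outside (down T₁⊆Δ (Δ-face b∈B)) (λ A⊆T₁ → x∉T₁ (A⊆T₁ x∈A))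
      transfer : FacetAvoiding k M′ T₁ b → FacetAvoiding k M T x
      transfer (facetAvoiding G uG G∈M′ |G|≡k T₁⊆G b∉G) =
        facetAvoiding G uG G∈M |G|≡k (⊆-trans T⊆T₁ T₁⊆G) (A⊈M′ G∈M′ ∘ A⊆G)
        where
        G∈M : M G
        G∈M = [ id , (λ (_ , B⊆G) → contradiction (B⊆G b∈B) b∉G) ]′ (M′-face G∈M′)
        A⊆G : x ∈ G → A ⊆ G
        A⊆G x∈G {z} z∈A with z ≟ x
        ... | yes refl = x∈G
        ... | no  z≢x  = T₁⊆G (∈-++⁺ˡ (∈-removeV⁺ z∈A z≢x))

    pure : Pure k M
    pure = record { size≤ = size≤ ; extend = extend }
      where
      size≤ : ∀ {T} → Unique T → M T → length T ≤ k
      size≤ {T} uT T∈M with T ⊆? A ++ B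
      ... | no  T⊈A∪B = size′≤ uT (M′-outside T∈M (λ A⊆T → T⊈A∪B (star-A T∈M A⊆T)))
      ... | yes T⊆A∪B with ⊈⇒missing (B∉M ∘ flip down T∈M)
      ...   | b , b∈B , b∉T = subst (length T ≤_) (Δ-size b∈B) (unique-⊆⇒length≤ uT (⊆Δ T⊆A∪B b∉T))
      extend : ∀ {T x} → M T → x ∉ T → FacetAvoiding k M T x
      extend {T} {x} T∈M x∉T with T ⊆? A ++ B
      ... | no  T⊈A∪B = extend-outside T∈M T⊈A∪B x∉T
      ... | yes T⊆A∪B with choose-missing x (B∉M ∘ flip down T∈M) x∉T | x ∈? A
      ...   | b , b∈B , b∉T , _     | yes x∈A = extend-from-A T⊆A∪B x∉T x∈A b∈B b∉T
      ...   | b , b∈B , b∉T , x∉B-b | no  x∉A =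
        facetAvoiding (Δ b) (Δ-unique b) (Δ-face b∈B) (Δ-size b∈B) (⊆Δ T⊆A∪B b∉T)
                      ([ x∉B-b , x∉A ]′ ∘ ∈-++⁻ (removeV b B))

plSphere⇒pure : ∀ {k M} → Down M → PLSphere k M → Pure k M
plSphere⇒pure down (base B uB |B|≡1+k M≡∂B) = bdSimplex⇒pure uB |B|≡1+k M≡∂B
plSphere⇒pure down (move M′ (_ , _ , uA , uB , _ , _ , A∩B=∅ , size , _ , B∉M , lk-A , M′-def) sphere′) =
  pure (plSphere⇒pure down′ sphere′)
  where open BistellarMove down uA uB A∩B=∅ size B∉M lk-A M′-def

-- Dimension and the induction

record HasDimension (d : ℕ) (M : Cx) : Set where
  field
    size≤        : ∀ {T} → Unique T → M T → length T ≤ d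
    facet        : List ℕ
    facet-unique : Unique facet
    facet-face   : M facet
    facet-size   : length facet ≡ d

pure⇒hasDimension : ∀ {d M} → Pure d M → M [] → HasDimension d M
pure⇒hasDimension P []∈M = record
  { size≤        = size≤
  ; facet        = facet
  ; facet-unique = facet-unique
  ; facet-face   = facet-face
  ; facet-size   = facet-size
  }
  where
  open Pure P
  open FacetAvoiding (extend {x = 0} []∈M λ ())

hasDimension-unique : ∀ {d d′ M} → HasDimension d M → HasDimension d′ M → d ≡ d′
hasDimension-unique D D′ = ℕ.≤-antisym
  (subst (_≤ _) (H.facet-size D) (H.size≤ D′ (H.facet-unique D) (H.facet-face D)))
  (subst (_≤ _) (H.facet-size D′) (H.size≤ D (H.facet-unique D′) (H.facet-face D′)))
  where module H = HasDimension

bdSimplex-size : ∀ {d M B} → M [] → HasDimension d M → Unique B → B ≢ [] → BdSimplexOn M B →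
                 length B ≡ suc d
bdSimplex-size {B = []}    _    _   _  B≢[] _    = contradiction refl B≢[]
bdSimplex-size {B = _ ∷ _} []∈M dim uB _    M≡∂B =
  cong suc (hasDimension-unique (pure⇒hasDimension (bdSimplex⇒pure uB refl M≡∂B) []∈M) dim)

bdSimplex-fvec : ∀ {d M B} (c : IsComplex M) → Unique B → length B ≡ suc d → BdSimplexOn M B →
                 1 ≤ d → ∀ {j} → j ≤ d → fvec M c j ≡ suc d C j
bdSimplex-fvec {d} {M} {B} c uB |B|≡1+d M≡∂B 1≤d {j} j≤d = begin
  fvec M c j                         ≡⟨ fvec≡faceCount c j ⟩
  faceCount dec (vertices c) 0 j     ≡⟨ sumOver-cong (sublists (vertices c)) (λ {T} _ → small-faces T) ⟩
  faceCount (_⊆? B) (vertices c) 0 j ≡⟨ faceCount-⊆ uB (deduplicate-! _≟_ support) B⊆vertices j ⟩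
  length B C j                       ≡⟨ cong (_C j) |B|≡1+d ⟩
  suc d C j                          ∎
  where
  open ≡-Reasoning
  open IsComplex c
  B⊈small : ∀ {T} → length T ≤ d → ¬ B ⊆ T
  B⊈small |T|≤d B⊆T = ℕ.<⇒≱ (s≤s |T|≤d) (subst (_≤ _) |B|≡1+d (unique-⊆⇒length≤ uB B⊆T))
  small-faces : ∀ T → faceIndicator dec 0 j T ≡ faceIndicator (_⊆? B) 0 j T
  small-faces T = indicator-⇔
    ( (λ (|T|≡j , T∈M) → |T|≡j , proj₁ (proj₁ (M≡∂B T) T∈M))
    , (λ (|T|≡j , T⊆B) → |T|≡j , proj₂ (M≡∂B T) (T⊆B , B⊈small (subst (_≤ d) (sym |T|≡j) j≤d)))) _ _
  B⊆vertices : B ⊆ vertices c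
  B⊆vertices {z} z∈B = ∈-deduplicate⁺ _≟_ (supported (z ∷ []) z∈M (here refl))
    where
    z∈M : M (z ∷ [])
    z∈M = proj₂ (M≡∂B (z ∷ [])) ((λ { (here refl) → z∈B }) , B⊈small 1≤d)

module EdgeDimensions {M : Cx} (c : IsComplex M) {d″ : ℕ}
                      (links : ∀ w → M (w ∷ []) → PLSphere d″ (lk (w ∷ []) M))
                      {u v : ℕ} (u≢v : u ≢ v) (uv∈M : M (u ∷ v ∷ [])) where
  open IsComplex c

  private
    lk-vertex⇔ : ∀ {w T} → w ∉ T → lk (w ∷ []) M T ⇔ M (w ∷ T)
    lk-vertex⇔ w∉T = lk⇔ down λ { p (here refl) → w∉T p }

    vertex-face : ∀ {w T} → M (w ∷ T) → M (w ∷ [])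
    vertex-face = down λ { (here refl) → here refl }

    link-pure : ∀ {w} → M (w ∷ []) → Pure d″ (lk (w ∷ []) M)
    link-pure {w} w∈M = plSphere⇒pure (IsComplex.down (lk-isComplex c w∈M)) (links w w∈M)

    manifold-size≤ : ∀ {T} → Unique T → M T → length T ≤ suc d″
    manifold-size≤ {[]}    _   _    = z≤n
    manifold-size≤ {w ∷ T} uwT wT∈M =
      s≤s (Pure.size≤ (link-pure (vertex-face wT∈M)) (Unique.tail uwT)
                      (proj₂ (lk-vertex⇔ (unique-head uwT)) wT∈M))

    u∈M : M (u ∷ [])
    u∈M = vertex-face uv∈M

    u∉v : u ∉ v ∷ []
    u∉v (here u≡v) = u≢v u≡v

    facet-through-v : FacetAvoiding d″ (lk (u ∷ []) M) (v ∷ []) u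
    facet-through-v = Pure.extend (link-pure u∈M) (proj₂ (lk-vertex⇔ u∉v) uv∈M) u∉v

    facet-avoiding-v : FacetAvoiding d″ (lk (u ∷ []) M) [] v
    facet-avoiding-v = Pure.extend (link-pure u∈M) ((λ ()) , u∈M) λ ()

  d″-positive : 1 ≤ d″
  d″-positive = Pure.size≤ (link-pure u∈M) ([] ∷ []) (proj₂ (lk-vertex⇔ u∉v) uv∈M)

  manifold-dimension : HasDimension (suc d″) M
  manifold-dimension = record
    { size≤        = manifold-size≤
    ; facet        = u ∷ facet
    ; facet-unique = unique-∷ ∉facet facet-unique
    ; facet-face   = proj₁ (lk-vertex⇔ ∉facet) facet-face
    ; facet-size   = cong suc facet-size
    }
    where open FacetAvoiding facet-through-v

  link-dimension : HasDimension (pred d″) (lk (u ∷ v ∷ []) M)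
  link-dimension = record
    { size≤        = size≤
    ; facet        = removeV v facet
    ; facet-unique = removeV-unique facet-unique
    ; facet-face   = G-v∩uv=∅ , down G-v∪uv⊆G∪u (proj₂ facet-face)
    ; facet-size   = cong pred (trans (length-removeV facet-unique v∈G) facet-size)
    }
    where
    open FacetAvoiding facet-through-v
    size≤ : ∀ {T} → Unique T → lk (u ∷ v ∷ []) M T → length T ≤ pred d″
    size≤ {T} uT (T∩uv=∅ , T∪uv∈M) = ℕ.pred-mono-≤ (ℕ.≤-pred (begin
      suc (suc (length T))     ≡⟨ ℕ.+-comm 2 (length T) ⟩
      length T + 2             ≡⟨ length-++ T ⟨
      length (T ++ u ∷ v ∷ []) ≤⟨ manifold-size≤ (unique-++ uT ((u≢v ∷ []) ∷ [] ∷ []) T∩uv=∅) T∪uv∈M ⟩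
      suc d″                   ∎))
      where open ℕ.≤-Reasoning
    v∈G : v ∈ facet
    v∈G = ⊆facet (here refl)
    G-v∩uv=∅ : Disjoint (removeV v facet) (u ∷ v ∷ [])
    G-v∩uv=∅ p (here refl)         = ∉facet (removeV-⊆ facet p)
    G-v∩uv=∅ p (there (here refl)) = ∉-removeV facet p
    G-v∪uv⊆G∪u : removeV v facet ++ u ∷ v ∷ [] ⊆ facet ++ u ∷ []
    G-v∪uv⊆G∪u p with ∈-++⁻ (removeV v facet) p
    ... | inj₁ q                   = ∈-++⁺ˡ (removeV-⊆ facet q)
    ... | inj₂ (here refl)         = ∈-++⁺ʳ facet (here refl)
    ... | inj₂ (there (here refl)) = ∈-++⁺ˡ v∈G

  contract-dimension : HasDimension (suc d″) (Contract M u v)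
  contract-dimension = record
    { size≤        = size≤
    ; facet        = v ∷ facet
    ; facet-unique = unique-∷ ∉facet facet-unique
    ; facet-face   = ContractFace⇒Contract c u≢v (u∉v∷G , inj₂ (here refl , u∷v∷G-v∈M))
    ; facet-size   = cong suc facet-size
    }
    where
    open FacetAvoiding facet-avoiding-v
    u∉G : u ∉ facet
    u∉G p = proj₁ facet-face p (here refl)
    u∉v∷G : u ∉ v ∷ facet
    u∉v∷G (here u≡v) = u≢v u≡v
    u∉v∷G (there p)  = u∉G p
    u∷v∷G-v∈M : M (u ∷ removeV v (v ∷ facet))
    u∷v∷G-v∈M = subst (M ∘ (u ∷_)) (sym (trans (removeV-∷ facet) (removeV-∉ ∉facet)))
                      (proj₁ (lk-vertex⇔ u∉G) facet-face)
    size≤ : ∀ {T} → Unique T → Contract M u v T → length T ≤ suc d″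
    size≤ {T} uT T∈M/uv with Contract⇒ContractFace c u≢v T∈M/uv
    ... | _   , inj₁ T∈M              = manifold-size≤ uT T∈M
    ... | u∉T , inj₂ (v∈T , u∷T-v∈M) =
      subst (_≤ suc d″) (length-removeV uT v∈T)
            (manifold-size≤ (unique-∷ (u∉T ∘ removeV-⊆ T) (removeV-unique uT)) u∷T-v∈M)

sed⇒gNonneg : ∀ {d M} (c : IsComplex M) → HasDimension d M → SED M → GNonneg d (fvec M c)
sed⇒gNonneg c dim (bd _) zero _ = +≤+ z≤n
sed⇒gNonneg {d} {M} c dim (bd (B , uB , B≢[] , M≡∂B)) (suc i) 1+i≤d/2 =
  subst (+ 0 ≤ℤ_) (sym (gvec-bdSimplex d (fvec M c) i 1+i≤d f≡C)) (+≤+ z≤n)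
  where
  1+i≤d : suc i ≤ d
  1+i≤d = ℕ.≤-trans 1+i≤d/2 (ℕ.⌊n/2⌋≤n d)
  f≡C : ∀ {j} → j ≤ d → fvec M c j ≡ suc d C j
  f≡C = bdSimplex-fvec c uB (bdSimplex-size (IsComplex.hasEmpty c) dim uB B≢[] M≡∂B) M≡∂B
                       (ℕ.≤-trans (s≤s z≤n) 1+i≤d)
sed⇒gNonneg c dim (contr zero u v (lift (_ , no-vertex)) _ uv∈M _ _ _) =
  contradiction (IsComplex.down c (λ { (here refl) → here refl }) uv∈M) (no-vertex u)
sed⇒gNonneg c dim (contr (suc zero) u v (_ , links) u≢v uv∈M _ _ _) =
  contradiction d″-positive λ ()
  where open EdgeDimensions c links u≢v uv∈M
sed⇒gNonneg {M = M} c dim (contr (suc (suc e)) u v (_ , links) u≢v uv∈M link-condition sed-L sed-C) =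
  subst (λ d → GNonneg d (fvec M c)) (hasDimension-unique manifold-dimension dim)
        (gNonneg-contraction e (fvec-contraction c u≢v uv∈M link-condition)
          (sed⇒gNonneg (contract-isComplex c u≢v uv∈M) contract-dimension sed-C)
          (sed⇒gNonneg (lk-isComplex c uv∈M) link-dimension sed-L))
  where
  open EdgeDimensions c links u≢v uv∈M
  open ContractionCount using (fvec-contraction)

corollary5p3 : (d : ℕ) (S : Cx) (c : IsComplex S)
    → PLSphere d S → SED S
    → (i : ℕ) → i ≤ ⌊ d /2⌋ → (+ 0) ≤ℤ gvec d (fvec S c) i
corollary5p3 d S c sphere sed =
  sed⇒gNonneg c (pure⇒hasDimension (plSphere⇒pure (IsComplex.down c) sphere) (IsComplex.hasEmpty c)) sed
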